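{- Let $\ddot{\mathbb A}$ be a full relational BiKAT over a set of states $\Sigma$. For all relations $c,d,R,S$ on $\Sigma$: (i) the forward simulation $\forall\sigma,\sigma',\tau.\ \sigma R\sigma'\wedge\sigma\,c\,\tau\Rightarrow\exists\tau'.\ \sigma'\,d\,\tau'\wedge\tau S\tau'$ holds if and only if there is $W\in\ddot{\mathbb A}$ with $\dot R;W\le\dot R;W;\dot S$, $\dot R;\langle c]\le W;[\mathbf{hav}\rangle$ and $\dot R;W\le\langle\mathbf{hav}\mid d\rangle$; (ii) the backward simulation $\forall\sigma,\tau,\tau'.\ \sigma\,c\,\tau\wedge\tau S\tau'\Rightarrow\exists\sigma'.\ \sigma R\sigma'\wedge\sigma'\,d\,\tau'$ holds if and only if there is $W\in\ddot{\mathbb A}$ with $W;\dot S\le\dot R;W;\dot S$, $\langle c];\dot S\le[\mathbf{hav}\rangle;W$ and $W;\dot S\le\langle\mathbf{hav}\mid d\rangle$.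
   Context: A full relational BiKAT over $\Sigma$: the underlying KAT consists of all relations on $\Sigma$ with all sub-identities as tests ($1=id_\Sigma$, $0=\emptyset$, $;$ composition, $+$ union, ${}^*$ reflexive-transitive closure, $\neg p=id_\Sigma\setminus p$, $\le$ inclusion), and the BiKAT $\ddot{\mathbb A}$ consists of all relations on $\Sigma\times\Sigma$ with all sub-identities of $\Sigma\times\Sigma$ as tests, with the same operations. $\mathbf{hav}=\Sigma\times\Sigma$ is the top relation on $\Sigma$. $\langle c]=c\otimes id_\Sigma$, $[c\rangle=id_\Sigma\otimes c$, $\langle c\mid d\rangle=\langle c];[d\rangle$, where $(\sigma,\sigma')(R\otimes S)(\tau,\tau')$ iff $\sigma R\tau\wedge\sigma' S\tau'$. $\dot R$ is the sub-identity on $\Sigma\times\Sigma$ containing $((\sigma,\sigma'),(\sigma,\sigma'))$ iff $\sigma R\sigma'$. -}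

module Defs where

open import Level using (Level; _⊔_; suc; 0ℓ)
open import Data.Product using (Σ; ∃; _×_; _,_)
open import Data.Unit using (⊤)
open import Relation.Binary.PropositionalEquality using (_≡_)

Rel : Set → Set₁
Rel A = A → A → Set

_⨾_ : {A : Set} → Rel A → Rel A → Rel A
(R ⨾ S) x z = ∃ λ y → R x y × S y z
infixl 7 _⨾_

_⊑_ : {A : Set} → Rel A → Rel A → Set
R ⊑ S = ∀ x y → R x y → S x y
infix 4 _⊑_

idR : {A : Set} → Rel A
idR x y = x ≡ y

hav : {A : Set} → Rel A
hav _ _ = ⊤

_⊗_ : {A : Set} → Rel A → Rel A → Rel (A × A)
(R ⊗ S) (σ , σ') (τ , τ') = R σ τ × S σ' τ'

⟨_] : {A : Set} → Rel A → Rel (A × A)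
⟨ c ] = c ⊗ idR

[_⟩ : {A : Set} → Rel A → Rel (A × A)
[ c ⟩ = idR ⊗ c

⟨_∣_⟩ : {A : Set} → Rel A → Rel A → Rel (A × A)
⟨ c ∣ d ⟩ = ⟨ c ] ⨾ [ d ⟩

dot : {A : Set} → Rel A → Rel (A × A)
dot R p q = (p ≡ q) × R (Data.Product.proj₁ p) (Data.Product.proj₂ p)

ForwardSim : {A : Set} → Rel A → Rel A → Rel A → Rel A → Set
ForwardSim c d R S =
  ∀ σ σ' τ → R σ σ' → c σ τ → ∃ λ τ' → d σ' τ' × S τ τ'

BackwardSim : {A : Set} → Rel A → Rel A → Rel A → Rel A → Set
BackwardSim c d R S =
  ∀ σ τ τ' → c σ τ → S τ τ' → ∃ λ σ' → R σ σ' × d σ' τ'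

{-# OPTIONS --safe #-}
module Submission where

-- Each inequality unfolds to a pointwise statement about W on pairs of
-- states: composing with Ṙ or Ṡ restricts W to pairs related by R or S,
-- while [hav⟩ and ⟨hav ∣ d⟩ only constrain the right-hand components.
-- Read pointwise, W is a relational invariant, and the simulation is
-- equivalent to its existence: one direction chains the three conditions;
-- for the other, take W (σ , σ') (τ , τ') to be d σ' τ' × S τ τ' (forward)
-- or R σ σ' × d σ' τ' (backward), whose totality condition is then
-- literally the simulation.

open import Defs
open import Data.Product using (_×_; ∃; _,_)
open import Data.Product.Function.Dependent.Propositional using (Σ-⇔)
open import Data.Product.Function.NonDependent.Propositional using (_×-⇔_)
open import Data.Unit using (tt)
open import Function.Bundles using (_⇔_; mk⇔)
open import Function.Construct.Composition using (_⇔-∘_)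
open import Function.Construct.Identity using (↠-id)
open import Function.Construct.Symmetry using (⇔-sym)
open import Relation.Binary.PropositionalEquality using (refl)

module _ {A : Set} where

  dotR⨾W⊑dotR⨾W⨾dotS⇔ : (R S : Rel A) (W : Rel (A × A)) →
    (dot R ⨾ W ⊑ dot R ⨾ W ⨾ dot S) ⇔
    (∀ σ σ' τ τ' → R σ σ' → W (σ , σ') (τ , τ') → S τ τ')
  dotR⨾W⊑dotR⨾W⨾dotS⇔ R S W = mk⇔ to from
    where
    to : dot R ⨾ W ⊑ dot R ⨾ W ⨾ dot S →
         ∀ σ σ' τ τ' → R σ σ' → W (σ , σ') (τ , τ') → S τ τ'
    to le σ σ' τ τ' r w with le (σ , σ') (τ , τ') ((σ , σ') , (refl , r) , w)
    ... | _ , _ , (refl , s) = s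
    from : (∀ σ σ' τ τ' → R σ σ' → W (σ , σ') (τ , τ') → S τ τ') →
           dot R ⨾ W ⊑ dot R ⨾ W ⨾ dot S
    from inv (σ , σ') (τ , τ') (_ , (refl , r) , w) =
      (τ , τ') , ((σ , σ') , (refl , r) , w) , (refl , inv σ σ' τ τ' r w)

  dotR⨾⟨c]⊑W⨾[hav⟩⇔ : (c R : Rel A) (W : Rel (A × A)) →
    (dot R ⨾ ⟨ c ] ⊑ W ⨾ [ hav ⟩) ⇔
    (∀ σ σ' τ → R σ σ' → c σ τ → ∃ λ τ' → W (σ , σ') (τ , τ'))
  dotR⨾⟨c]⊑W⨾[hav⟩⇔ c R W = mk⇔ to from
    where
    to : dot R ⨾ ⟨ c ] ⊑ W ⨾ [ hav ⟩ →
         ∀ σ σ' τ → R σ σ' → c σ τ → ∃ λ τ' → W (σ , σ') (τ , τ')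
    to le σ σ' τ r cστ with le (σ , σ') (τ , σ') ((σ , σ') , (refl , r) , (cστ , refl))
    ... | (_ , τ') , w , (refl , _) = τ' , w
    from : (∀ σ σ' τ → R σ σ' → c σ τ → ∃ λ τ' → W (σ , σ') (τ , τ')) →
           dot R ⨾ ⟨ c ] ⊑ W ⨾ [ hav ⟩
    from total (σ , σ') (τ , _) (_ , (refl , r) , (cστ , refl)) with total σ σ' τ r cστ
    ... | τ' , w = (τ , τ') , w , (refl , tt)

  dotR⨾W⊑⟨hav∣d⟩⇔ : (d R : Rel A) (W : Rel (A × A)) →
    (dot R ⨾ W ⊑ ⟨ hav ∣ d ⟩) ⇔
    (∀ σ σ' τ τ' → R σ σ' → W (σ , σ') (τ , τ') → d σ' τ')
  dotR⨾W⊑⟨hav∣d⟩⇔ d R W = mk⇔ to from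
    where
    to : dot R ⨾ W ⊑ ⟨ hav ∣ d ⟩ →
         ∀ σ σ' τ τ' → R σ σ' → W (σ , σ') (τ , τ') → d σ' τ'
    to le σ σ' τ τ' r w with le (σ , σ') (τ , τ') ((σ , σ') , (refl , r) , w)
    ... | _ , (_ , refl) , (refl , dσ'τ') = dσ'τ'
    from : (∀ σ σ' τ τ' → R σ σ' → W (σ , σ') (τ , τ') → d σ' τ') →
           dot R ⨾ W ⊑ ⟨ hav ∣ d ⟩
    from inv (σ , σ') (τ , τ') (_ , (refl , r) , w) =
      (τ , σ') , (tt , refl) , (refl , inv σ σ' τ τ' r w)

  W⨾dotS⊑dotR⨾W⨾dotS⇔ : (R S : Rel A) (W : Rel (A × A)) →
    (W ⨾ dot S ⊑ dot R ⨾ W ⨾ dot S) ⇔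
    (∀ σ σ' τ τ' → W (σ , σ') (τ , τ') → S τ τ' → R σ σ')
  W⨾dotS⊑dotR⨾W⨾dotS⇔ R S W = mk⇔ to from
    where
    to : W ⨾ dot S ⊑ dot R ⨾ W ⨾ dot S →
         ∀ σ σ' τ τ' → W (σ , σ') (τ , τ') → S τ τ' → R σ σ'
    to le σ σ' τ τ' w s with le (σ , σ') (τ , τ') ((τ , τ') , w , (refl , s))
    ... | _ , (_ , (refl , r) , _) , _ = r
    from : (∀ σ σ' τ τ' → W (σ , σ') (τ , τ') → S τ τ' → R σ σ') →
           W ⨾ dot S ⊑ dot R ⨾ W ⨾ dot S
    from inv (σ , σ') (τ , τ') (_ , w , (refl , s)) =
      (τ , τ') , ((σ , σ') , (refl , inv σ σ' τ τ' w s) , w) , (refl , s)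

  ⟨c]⨾dotS⊑[hav⟩⨾W⇔ : (c S : Rel A) (W : Rel (A × A)) →
    (⟨ c ] ⨾ dot S ⊑ [ hav ⟩ ⨾ W) ⇔
    (∀ σ τ τ' → c σ τ → S τ τ' → ∃ λ σ' → W (σ , σ') (τ , τ'))
  ⟨c]⨾dotS⊑[hav⟩⨾W⇔ c S W = mk⇔ to from
    where
    to : ⟨ c ] ⨾ dot S ⊑ [ hav ⟩ ⨾ W →
         ∀ σ τ τ' → c σ τ → S τ τ' → ∃ λ σ' → W (σ , σ') (τ , τ')
    to le σ τ τ' cστ s with le (σ , τ') (τ , τ') ((τ , τ') , (cστ , refl) , (refl , s))
    ... | (_ , σ') , (refl , _) , w = σ' , w
    from : (∀ σ τ τ' → c σ τ → S τ τ' → ∃ λ σ' → W (σ , σ') (τ , τ')) →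
           ⟨ c ] ⨾ dot S ⊑ [ hav ⟩ ⨾ W
    from total (σ , _) (τ , τ') (_ , (cστ , refl) , (refl , s)) with total σ τ τ' cστ s
    ... | σ' , w = (σ , σ') , (refl , tt) , w

  W⨾dotS⊑⟨hav∣d⟩⇔ : (d S : Rel A) (W : Rel (A × A)) →
    (W ⨾ dot S ⊑ ⟨ hav ∣ d ⟩) ⇔
    (∀ σ σ' τ τ' → W (σ , σ') (τ , τ') → S τ τ' → d σ' τ')
  W⨾dotS⊑⟨hav∣d⟩⇔ d S W = mk⇔ to from
    where
    to : W ⨾ dot S ⊑ ⟨ hav ∣ d ⟩ →
         ∀ σ σ' τ τ' → W (σ , σ') (τ , τ') → S τ τ' → d σ' τ'
    to le σ σ' τ τ' w s with le (σ , σ') (τ , τ') ((τ , τ') , w , (refl , s))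
    ... | _ , (_ , refl) , (refl , dσ'τ') = dσ'τ'
    from : (∀ σ σ' τ τ' → W (σ , σ') (τ , τ') → S τ τ' → d σ' τ') →
           W ⨾ dot S ⊑ ⟨ hav ∣ d ⟩
    from inv (σ , σ') (τ , τ') (_ , w , (refl , s)) =
      (τ , σ') , (tt , refl) , (refl , inv σ σ' τ τ' w s)

module _ {A : Set} (c d R S : Rel A) where

  ForwardInvariant : Rel (A × A) → Set
  ForwardInvariant W =
      (∀ σ σ' τ τ' → R σ σ' → W (σ , σ') (τ , τ') → S τ τ')
    × (∀ σ σ' τ → R σ σ' → c σ τ → ∃ λ τ' → W (σ , σ') (τ , τ'))
    × (∀ σ σ' τ τ' → R σ σ' → W (σ , σ') (τ , τ') → d σ' τ')

  BackwardInvariant : Rel (A × A) → Set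
  BackwardInvariant W =
      (∀ σ σ' τ τ' → W (σ , σ') (τ , τ') → S τ τ' → R σ σ')
    × (∀ σ τ τ' → c σ τ → S τ τ' → ∃ λ σ' → W (σ , σ') (τ , τ'))
    × (∀ σ σ' τ τ' → W (σ , σ') (τ , τ') → S τ τ' → d σ' τ')

  ForwardInequalities : Rel (A × A) → Set
  ForwardInequalities W =
      (dot R ⨾ W ⊑ dot R ⨾ W ⨾ dot S)
    × (dot R ⨾ ⟨ c ] ⊑ W ⨾ [ hav ⟩)
    × (dot R ⨾ W ⊑ ⟨ hav ∣ d ⟩)

  BackwardInequalities : Rel (A × A) → Set
  BackwardInequalities W =
      (W ⨾ dot S ⊑ dot R ⨾ W ⨾ dot S)
    × (⟨ c ] ⨾ dot S ⊑ [ hav ⟩ ⨾ W)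
    × (W ⨾ dot S ⊑ ⟨ hav ∣ d ⟩)

  forwardInequalities⇔forwardInvariant : (W : Rel (A × A)) → ForwardInequalities W ⇔ ForwardInvariant W
  forwardInequalities⇔forwardInvariant W =
        dotR⨾W⊑dotR⨾W⨾dotS⇔ R S W
    ×-⇔ dotR⨾⟨c]⊑W⨾[hav⟩⇔ c R W
    ×-⇔ dotR⨾W⊑⟨hav∣d⟩⇔ d R W

  backwardInequalities⇔backwardInvariant : (W : Rel (A × A)) → BackwardInequalities W ⇔ BackwardInvariant W
  backwardInequalities⇔backwardInvariant W =
        W⨾dotS⊑dotR⨾W⨾dotS⇔ R S W
    ×-⇔ ⟨c]⨾dotS⊑[hav⟩⨾W⇔ c S W
    ×-⇔ W⨾dotS⊑⟨hav∣d⟩⇔ d S W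

  forwardSim⇔∃forwardInvariant : ForwardSim c d R S ⇔ ∃ ForwardInvariant
  forwardSim⇔∃forwardInvariant = mk⇔ to from
    where
    to : ForwardSim c d R S → ∃ ForwardInvariant
    to sim = (λ { (_ , σ') (τ , τ') → d σ' τ' × S τ τ' })
           , (λ _ _ _ _ _ (_ , s) → s)
           , sim
           , (λ _ _ _ _ _ (dσ'τ' , _) → dσ'τ')
    from : ∃ ForwardInvariant → ForwardSim c d R S
    from (_ , post , total , step) σ σ' τ r cστ =
      let τ' , w = total σ σ' τ r cστ
      in τ' , step σ σ' τ τ' r w , post σ σ' τ τ' r w

  backwardSim⇔∃backwardInvariant : BackwardSim c d R S ⇔ ∃ BackwardInvariant
  backwardSim⇔∃backwardInvariant = mk⇔ to from
    where
    to : BackwardSim c d R S → ∃ BackwardInvariant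
    to sim = (λ { (σ , σ') (_ , τ') → R σ σ' × d σ' τ' })
           , (λ _ _ _ _ (r , _) _ → r)
           , sim
           , (λ _ _ _ _ (_ , dσ'τ') _ → dσ'τ')
    from : ∃ BackwardInvariant → BackwardSim c d R S
    from (_ , pre , total , step) σ τ τ' cστ s =
      let σ' , w = total σ τ τ' cστ s
      in σ' , pre σ σ' τ τ' w s , step σ σ' τ τ' w s

theorem7p3 : {A : Set} (c d R S : Rel A) →
    (ForwardSim c d R S ⇔
      ∃ λ (W : Rel (A × A)) →
        (dot R ⨾ W ⊑ dot R ⨾ W ⨾ dot S)
        × (dot R ⨾ ⟨ c ] ⊑ W ⨾ [ hav ⟩)
        × (dot R ⨾ W ⊑ ⟨ hav ∣ d ⟩))
    × (BackwardSim c d R S ⇔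
      ∃ λ (W : Rel (A × A)) →
        (W ⨾ dot S ⊑ dot R ⨾ W ⨾ dot S)
        × (⟨ c ] ⨾ dot S ⊑ [ hav ⟩ ⨾ W)
        × (W ⨾ dot S ⊑ ⟨ hav ∣ d ⟩))
theorem7p3 c d R S =
    ⇔-sym (Σ-⇔ (↠-id _) (forwardInequalities⇔forwardInvariant c d R S _))
      ⇔-∘ forwardSim⇔∃forwardInvariant c d R S
  , ⇔-sym (Σ-⇔ (↠-id _) (backwardInequalities⇔backwardInvariant c d R S _))
      ⇔-∘ backwardSim⇔∃backwardInvariant c d R S
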